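{- Let $k\geq 1$, let $A,B$ be $k$-connected graphs, and let $f:V(A)\to V(B)$ be a function such that for every $a\in V(A)$ we have $|\{f(a') : aa'\in E(A)\}|\geq k$. Then $A\otimes_f B$ is $k$-connected.
   Context: All graphs are finite and simple. A graph $G$ is $k$-connected if it has more than $k$ vertices and removing any set of fewer than $k$ vertices leaves a connected graph. For graphs $A,B$ and a function $f:V(A)\to V(B)$, the Sierpiński product $A\otimes_f B$ is the graph with vertex set $V(A)\times V(B)$ and edge set $\{(a,b_1)(a,b_2): a\in V(A),\ b_1b_2\in E(B)\}\cup\{(a_1,f(a_2))(a_2,f(a_1)) : a_1a_2\in E(A)\}$. -}

module Defs where

open import Level using (0ℓ)
open import Data.Nat using (ℕ; _<_; _≥_; _*_)
open import Data.Fin using (Fin; remQuot)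
open import Data.Fin.Subset using (Subset; _∉_; ∣_∣)
open import Data.Product using (Σ; _×_; _,_; ∃; proj₁; proj₂)
open import Relation.Binary.PropositionalEquality using (_≡_)
open import Relation.Nullary using (¬_)
open import Function.Definitions using (Injective)

record Graph : Set₁ where
  field
    n      : ℕ
    Adj    : Fin n → Fin n → Set
    sym    : ∀ {u v} → Adj u v → Adj v u
    irrefl : ∀ {u} → ¬ Adj u u

open Graph public

data WalkAvoiding (G : Graph) (S : Subset (n G)) : Fin (n G) → Fin (n G) → Set where
  here : ∀ {u} → u ∉ S → WalkAvoiding G S u u
  step : ∀ {u w v} → u ∉ S → Adj G u w → WalkAvoiding G S w v → WalkAvoiding G S u v

ConnectedAvoiding : (G : Graph) → Subset (n G) → Set
ConnectedAvoiding G S = ∀ u v → u ∉ S → v ∉ S → WalkAvoiding G S u v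

KConnected : ℕ → Graph → Set
KConnected k G = (n G > k) × (∀ (S : Subset (n G)) → ∣ S ∣ < k → ConnectedAvoiding G S)
  where open import Data.Nat using (_>_)

-- Sierpinski product A ⊗_f B.  Vertex set V(A) × V(B), encoded as
-- Fin (n A * n B) via the standard bijection remQuot / combine.
data SAdj (A B : Graph) (f : Fin (n A) → Fin (n B)) :
          Fin (n A) × Fin (n B) → Fin (n A) × Fin (n B) → Set where
  inside : ∀ a {b₁ b₂} → Adj B b₁ b₂ → SAdj A B f (a , b₁) (a , b₂)
  across : ∀ {a₁ a₂} → Adj A a₁ a₂ → SAdj A B f (a₁ , f a₂) (a₂ , f a₁)

SAdj-sym : ∀ {A B f x y} → SAdj A B f x y → SAdj A B f y x
SAdj-sym {A} {B} (inside a e) = inside a (sym B e)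
SAdj-sym {A} {B} (across e)   = across (sym A e)

SAdj-irrefl : ∀ {A B f x} → ¬ SAdj A B f x x
SAdj-irrefl {A} {B} (inside a e) = irrefl B e
SAdj-irrefl {A} {B} (across e)   = irrefl A e

sierpinski : (A B : Graph) → (Fin (n A) → Fin (n B)) → Graph
sierpinski A B f = record
  { n      = n A * n B
  ; Adj    = λ u v → SAdj A B f (remQuot (n B) u) (remQuot (n B) v)
  ; sym    = SAdj-sym
  ; irrefl = SAdj-irrefl
  }

-- |{ f(a') : a a' ∈ E(A) }| ≥ k : there are k distinct vertices of B, each
-- of the form f(a') for some neighbour a' of a.
NeighbourImageAtLeast : (A B : Graph) → (Fin (n A) → Fin (n B)) → Fin (n A) → ℕ → Set
NeighbourImageAtLeast A B f a k =
  Σ (Fin k → Fin (n B)) λ g → Injective _≡_ _≡_ g ×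
    (∀ i → ∃ λ a' → Adj A a a' × f a' ≡ g i)

{-# OPTIONS --safe #-}
-- Let S be a set of fewer than k vertices of A ⊗_f B and call a ∈ V(A) hit if the copy
-- {a} × B meets S.  Fewer than k vertices are hit, so A minus the hit vertices is
-- connected; every copy minus S is connected since B is k-connected, and an edge aa'
-- of A yields the crossing edge (a, f a')(a', f a).  Hence all vertices in unhit copies
-- are joined.  A vertex (a, b) ∉ S reaches an unhit copy: a has k neighbours a'ᵢ with
-- distinct images f a'ᵢ, and each i for which (a, f a'ᵢ) ∈ S or a'ᵢ is hit uses up a
-- different vertex of S.  So some i is free: (a, b) reaches (a, f a'ᵢ) inside its copy,
-- and the crossing edge to (a'ᵢ, f a) enters the unhit copy of a'ᵢ.
module Submission where

open import Defs hiding (sym)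
open import Level using (Level)
open import Data.Nat using (ℕ; _*_; _≥_; _≤_; _<_; z≤n; s≤s; >-nonZero)
open import Data.Nat.Properties using (≤-trans; ≤-<-trans; <⇒≱; m≤m*n)
open import Data.Fin using (Fin; zero; suc; combine; remQuot)
open import Data.Fin.Properties
  using ( remQuot-combine; combine-remQuot; combine-injectiveˡ; combine-injectiveʳ
        ; any?; all?; ¬∀⟶∃¬; suc-injective; 0≢1+n)
open import Data.Fin.Subset using (Subset; _∈_; _∉_; ∣_∣; _-_; inside; outside; ⊤)
open import Data.Fin.Subset.Properties
  using (_∈?_; x∈p⇒∣p-x∣<∣p∣; x∈p∧x≢y⇒x∈p-y; ∣⊤∣≡n)
open import Data.Vec using ([]; _∷_; tabulate; here; there)
open import Data.Vec.Properties using (lookup∘tabulate; []=⇒lookup; lookup⇒[]=)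
open import Data.Product using (Σ-syntax; ∃-syntax; _×_; _,_; proj₁; proj₂; uncurry)
open import Data.Sum using (_⊎_; inj₁; inj₂)
open import Function using (_∘_)
open import Function.Definitions using (Injective)
open import Relation.Nullary using (¬_; yes; no; does; contradiction)
open import Relation.Nullary.Decidable using (dec-true; _⊎-dec_)
open import Relation.Unary using (Pred; Decidable)
open import Relation.Binary.PropositionalEquality using (_≡_; refl; sym; trans; cong; subst; subst₂)

private
  variable
    ℓ : Level
    m k : ℕ

module _ {P : Pred (Fin m) ℓ} (P? : Decidable P) where

  satisfying : Subset m
  satisfying = tabulate (does ∘ P?)

  ∈-satisfying⁺ : ∀ {x} → P x → x ∈ satisfying
  ∈-satisfying⁺ {x} px =
    lookup⇒[]= x _ (trans (lookup∘tabulate (does ∘ P?) x) (dec-true (P? x) px))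

  ∈-satisfying⁻ : ∀ {x} → x ∈ satisfying → P x
  ∈-satisfying⁻ {x} x∈ with P? x | trans (sym (lookup∘tabulate (does ∘ P?) x)) ([]=⇒lookup x∈)
  ... | yes px | _ = px
  ... | no _   | ()

injection⇒∣p∣≤∣q∣ : ∀ {n} (p : Subset m) (q : Subset n) (h : ∀ x → x ∈ p → Fin n) →
  (∀ {x y} x∈p y∈p → h x x∈p ≡ h y y∈p → x ≡ y) → (∀ x x∈p → h x x∈p ∈ q) → ∣ p ∣ ≤ ∣ q ∣
injection⇒∣p∣≤∣q∣ [] q h h-inj h∈q = z≤n
injection⇒∣p∣≤∣q∣ (outside ∷ p) q h h-inj h∈q =
  injection⇒∣p∣≤∣q∣ p q (λ x → h (suc x) ∘ there)
    (λ _ _ → suc-injective ∘ h-inj _ _) (λ x → h∈q (suc x) ∘ there)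
injection⇒∣p∣≤∣q∣ (inside ∷ p) q h h-inj h∈q =
  ≤-trans (s≤s ∣p∣≤∣q-h₀∣) (x∈p⇒∣p-x∣<∣p∣ (h∈q zero here))
  where
  ∣p∣≤∣q-h₀∣ : ∣ p ∣ ≤ ∣ q - h zero here ∣
  ∣p∣≤∣q-h₀∣ = injection⇒∣p∣≤∣q∣ p (q - h zero here) (λ x → h (suc x) ∘ there)
    (λ _ _ → suc-injective ∘ h-inj _ _)
    (λ x x∈p → x∈p∧x≢y⇒x∈p-y (h∈q (suc x) (there x∈p)) (0≢1+n ∘ sym ∘ h-inj _ _))

pigeonhole : ∀ {n} {P : Pred (Fin k) ℓ} → Decidable P → (q : Subset n) → ∣ q ∣ < k →
  (h : ∀ i → P i → Fin n) → (∀ {i j} pi pj → h i pi ≡ h j pj → i ≡ j) → (∀ i pi → h i pi ∈ q) →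
  ∃[ i ] ¬ P i
pigeonhole {k} {P = P} P? q ∣q∣<k h h-inj h∈q with all? P?
... | no ¬∀P = ¬∀⟶∃¬ k P P? ¬∀P
... | yes ∀P = contradiction k≤∣q∣ (<⇒≱ ∣q∣<k)
  where
  k≤∣q∣ : k ≤ ∣ q ∣
  k≤∣q∣ = subst (_≤ ∣ q ∣) (∣⊤∣≡n k)
    (injection⇒∣p∣≤∣q∣ ⊤ q (λ i _ → h i (∀P i))
      (λ _ _ → h-inj (∀P _) (∀P _)) (λ i _ → h∈q i (∀P i)))

module _ {G : Graph} {S : Subset (n G)} where

  infixr 5 _++_

  _++_ : ∀ {u w v} → WalkAvoiding G S u w → WalkAvoiding G S w v → WalkAvoiding G S u v
  here _        ++ q = q
  step u∉ e p   ++ q = step u∉ e (p ++ q)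

  start∉ : ∀ {u v} → WalkAvoiding G S u v → u ∉ S
  start∉ (here u∉)     = u∉
  start∉ (step u∉ _ _) = u∉

  reverse : ∀ {u v} → WalkAvoiding G S u v → WalkAvoiding G S v u
  reverse (here u∉)     = here u∉
  reverse (step u∉ e p) = reverse p ++ step (start∉ p) (Graph.sym G e) (here u∉)

map : ∀ {G H : Graph} {S : Subset (n G)} {T : Subset (n H)} (h : Fin (n G) → Fin (n H)) →
  (∀ {u v} → Adj G u v → Adj H (h u) (h v)) → (∀ {u} → u ∉ S → h u ∉ T) →
  ∀ {u v} → WalkAvoiding G S u v → WalkAvoiding H T (h u) (h v)
map h h-adj h-∉ (here u∉)     = here (h-∉ u∉)
map h h-adj h-∉ (step u∉ e p) = step (h-∉ u∉) (h-adj e) (map h h-adj h-∉ p)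

∀-combine : ∀ {n} (P : Pred (Fin (m * n)) ℓ) → (∀ a b → P (combine a b)) → ∀ u → P u
∀-combine {m = m} {n = n} P P-combine u =
  subst P (combine-remQuot {m} n u) (uncurry P-combine (remQuot {m} n u))

SAdj⇒Adj : ∀ {A B : Graph} {f : Fin (n A) → Fin (n B)} {x y} →
  SAdj A B f x y → Adj (sierpinski A B f) (uncurry combine x) (uncurry combine y)
SAdj⇒Adj {A} {B} {f} {x} {y} =
  subst₂ (SAdj A B f) (sym (remQuot-combine (proj₁ x) (proj₂ x)))
                      (sym (remQuot-combine (proj₁ y) (proj₂ y)))

distinct-neighbours : ∀ {A B : Graph} {f : Fin (n A) → Fin (n B)} {a} →
  NeighbourImageAtLeast A B f a k →
  Σ[ a′ ∈ (Fin k → Fin (n A)) ] (∀ i → Adj A a (a′ i)) × Injective _≡_ _≡_ (f ∘ a′)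
distinct-neighbours (g , g-inj , nbr) =
  proj₁ ∘ nbr , proj₁ ∘ proj₂ ∘ nbr ,
  λ {i} {j} e → g-inj (trans (sym (proj₂ (proj₂ (nbr i)))) (trans e (proj₂ (proj₂ (nbr j)))))

module AvoidingSmallSet {k} (A B : Graph) (f : Fin (n A) → Fin (n B))
  (A-conn : ∀ (X : Subset (n A)) → ∣ X ∣ < k → ConnectedAvoiding A X)
  (B-conn : ∀ (T : Subset (n B)) → ∣ T ∣ < k → ConnectedAvoiding B T)
  (nbr : ∀ a → NeighbourImageAtLeast A B f a k)
  (S : Subset (n A * n B)) (∣S∣<k : ∣ S ∣ < k) where

  Walk : Fin (n A * n B) → Fin (n A * n B) → Set
  Walk = WalkAvoiding (sierpinski A B f) S

  fibre? : (a : Fin (n A)) → Decidable (λ (b : Fin (n B)) → combine a b ∈ S)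
  fibre? a b = combine a b ∈? S

  fibre : Fin (n A) → Subset (n B)
  fibre a = satisfying (fibre? a)

  ∣fibre∣<k : ∀ a → ∣ fibre a ∣ < k
  ∣fibre∣<k a = ≤-<-trans
    (injection⇒∣p∣≤∣q∣ (fibre a) S (λ b _ → combine a b)
      (λ _ _ → combine-injectiveʳ a _ a _) (λ _ → ∈-satisfying⁻ (fibre? a)))
    ∣S∣<k

  fibre-walk : ∀ {a b b′} → combine a b ∉ S → combine a b′ ∉ S →
               Walk (combine a b) (combine a b′)
  fibre-walk {a} {b} {b′} ab∉ ab′∉ =
    map (combine a) (SAdj⇒Adj ∘ inside a) (λ b∉ → b∉ ∘ ∈-satisfying⁺ (fibre? a))
      (B-conn (fibre a) (∣fibre∣<k a) b b′
        (ab∉ ∘ ∈-satisfying⁻ (fibre? a)) (ab′∉ ∘ ∈-satisfying⁻ (fibre? a)))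

  meets-S? : Decidable (λ (a : Fin (n A)) → ∃[ b ] combine a b ∈ S)
  meets-S? a = any? (λ b → combine a b ∈? S)

  hit : Subset (n A)
  hit = satisfying meets-S?

  hit-at : ∀ {a} → a ∈ hit → Fin (n B)
  hit-at = proj₁ ∘ ∈-satisfying⁻ meets-S?

  hit-at-∈ : ∀ {a} (a∈ : a ∈ hit) → combine a (hit-at a∈) ∈ S
  hit-at-∈ = proj₂ ∘ ∈-satisfying⁻ meets-S?

  unhit : ∀ {a b} → a ∉ hit → combine a b ∉ S
  unhit {b = b} a∉ ab∈ = a∉ (∈-satisfying⁺ meets-S? (b , ab∈))

  ∣hit∣<k : ∣ hit ∣ < k
  ∣hit∣<k = ≤-<-trans
    (injection⇒∣p∣≤∣q∣ hit S (λ a → combine a ∘ hit-at)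
      (λ _ _ → combine-injectiveˡ _ _ _ _) (λ _ → hit-at-∈))
    ∣S∣<k

  unhit-walk : ∀ {a a′} → WalkAvoiding A hit a a′ → ∀ b b′ → Walk (combine a b) (combine a′ b′)
  unhit-walk (here a∉) b b′ = fibre-walk (unhit a∉) (unhit a∉)
  unhit-walk {a} (step {w = a″} a∉ e p) b b′ =
    fibre-walk {b′ = f a″} (unhit a∉) (unhit a∉)
      ++ step (unhit a∉) (SAdj⇒Adj (across e)) (unhit-walk p (f a) b′)

  Escapes : Fin (n A * n B) → Set
  Escapes u = ∃[ a ] ∃[ b ] a ∉ hit × Walk u (combine a b)

  escape-from : ∀ a b → combine a b ∉ S → Escapes (combine a b)
  escape-from a b ab∉ with distinct-neighbours {A = A} {B} {f} (nbr a)
  ... | a′ , adj , fa′-inj =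
    escape-via (pigeonhole blocked? S ∣S∣<k witness witness-inj witness-∈)
    where
    Blocked : Fin k → Set
    Blocked i = combine a (f (a′ i)) ∈ S ⊎ a′ i ∈ hit

    blocked? : Decidable Blocked
    blocked? i = (combine a (f (a′ i)) ∈? S) ⊎-dec (a′ i ∈? hit)

    witness : ∀ i → Blocked i → Fin (n A * n B)
    witness i (inj₁ _)  = combine a (f (a′ i))
    witness i (inj₂ a∈) = combine (a′ i) (hit-at a∈)

    witness-∈ : ∀ i blocked → witness i blocked ∈ S
    witness-∈ i (inj₁ ab∈) = ab∈
    witness-∈ i (inj₂ a∈)  = hit-at-∈ a∈

    a≢a′ : ∀ i → ¬ a ≡ a′ i
    a≢a′ i refl = Graph.irrefl A (adj i)

    witness-inj : ∀ {i j} bi bj → witness i bi ≡ witness j bj → i ≡ j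
    witness-inj (inj₁ _) (inj₁ _) e = fa′-inj (combine-injectiveʳ a _ a _ e)
    witness-inj {i} {j} (inj₂ _) (inj₂ _) e =
      fa′-inj (cong f (combine-injectiveˡ (a′ i) _ (a′ j) _ e))
    witness-inj {j = j} (inj₁ _) (inj₂ _) e with () ← a≢a′ j (combine-injectiveˡ a _ (a′ j) _ e)
    witness-inj {i = i} (inj₂ _) (inj₁ _) e
      with () ← a≢a′ i (sym (combine-injectiveˡ (a′ i) _ a _ e))

    escape-via : ∃[ i ] ¬ Blocked i → Escapes (combine a b)
    escape-via (i , free) = a′ i , f a , free ∘ inj₂ ,
      fibre-walk ab∉ (free ∘ inj₁)
        ++ step (free ∘ inj₁) (SAdj⇒Adj (across (adj i))) (here (unhit (free ∘ inj₂)))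

  escape : ∀ u → u ∉ S → Escapes u
  escape = ∀-combine (λ u → u ∉ S → Escapes u) escape-from

  connected : ConnectedAvoiding (sierpinski A B f) S
  connected u v u∉ v∉ with escape u u∉ | escape v v∉
  ... | a , b , a∉ , p | a′ , b′ , a′∉ , q =
    p ++ unhit-walk (A-conn hit ∣hit∣<k a a′ a∉ a′∉) b b′ ++ reverse q

theorem1p2 : (k : ℕ) → k ≥ 1 → (A B : Graph) → KConnected k A → KConnected k B →
    (f : Fin (n A) → Fin (n B)) →
    (∀ a → NeighbourImageAtLeast A B f a k) →
    KConnected k (sierpinski A B f)
-- The argument does not need k ≥ 1.
theorem1p2 k _ A B (k<∣A∣ , A-conn) (k<∣B∣ , B-conn) f nbr =
  ≤-trans k<∣A∣ (m≤m*n (n A) (n B) {{>-nonZero (≤-<-trans z≤n k<∣B∣)}}) ,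
  AvoidingSmallSet.connected A B f A-conn B-conn nbr
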